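{- Let $G$ be a formula. For every $\mathbf{FRJ}(G)$-sequent $\sigma$ define $\mathrm{wg}(\sigma)=\langle |\mathrm{Cl}(\mathrm{Lhs}(\sigma))\cap\mathrm{Sl}(G)|,\ \mathrm{tp}(\sigma),\ |G|-|\mathrm{Rhs}(\sigma)|\rangle$, where $\mathrm{tp}(\sigma)=0$ if $\sigma$ is regular and $1$ if it is irregular, $|\cdot|$ on sets is cardinality and on formulas the number of symbols. If $\sigma_1\mapsto\sigma_2$, then $\langle0,0,0\rangle\preceq\mathrm{wg}(\sigma_2)\prec\mathrm{wg}(\sigma_1)$, where $\prec$ is the lexicographic order on triples of integers.
   Context: Formulas are built from a countably infinite set $\mathcal{V}$ of propositional variables and $\bot$ using $\land,\lor,\supset$. Let $\mathcal{V}_\bot=\mathcal{V}\cup\{\bot\}$, $\mathcal{L}^{\supset}$ the set of formulas with main connective $\supset$. For a formula $G$, $\mathrm{Sl}(G)$ and $\mathrm{Sr}(G)$ are the smallest subsets of the subformulas of $G$ with: $G\in\mathrm{Sr}(G)$; $A\land B$ or $A\lor B$ in $\mathrm{Sl}(G)$ (resp. $\mathrm{Sr}(G)$) implies $A,B$ in $\mathrm{Sl}(G)$ (resp. $\mathrm{Sr}(G)$); $A\supset B\in\mathrm{Sl}(G)$ implies $B\in\mathrm{Sl}(G)$, $A\in\mathrm{Sr}(G)$; $A\supset B\in\mathrm{Sr}(G)$ implies $B\in\mathrm{Sr}(G)$, $A\in\mathrm{Sl}(G)$. $\mathrm{Cl}(\Gamma)$ is the smallest set containing $\Gamma$ such that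 if $X,Y\in\mathrm{Cl}(\Gamma)$ and $A$ is any formula then $X\land Y,A\lor X,X\lor A,A\supset X\in\mathrm{Cl}(\Gamma)$. $\mathbf{FRJ}(G)$: let $\bar\Gamma^{At}=\mathrm{Sl}(G)\cap\mathcal V$, $\bar\Gamma^{\supset}=\mathrm{Sl}(G)\cap\mathcal L^{\supset}$, $\bar\Gamma=\bar\Gamma^{At}\cup\bar\Gamma^{\supset}$. Sequents: regular $\Gamma\Rightarrow C$ ($\Gamma\subseteq\bar\Gamma$, $C\in\mathrm{Sr}(G)$), irregular $\Sigma;\Theta\rightarrow C$ ($\Sigma\cup\Theta\subseteq\bar\Gamma$, $C\in\mathrm{Sr}(G)$); $\mathrm{Lhs}$ is $\Gamma$, resp. $\Sigma\cup\Theta$, and $\mathrm{Rhs}$ is $C$; conclusions always have right formula in $\mathrm{Sr}(G)$. Rules ($F\in\mathcal V_\bot$, $k\in\{1,2\}$): axioms $\bar\Gamma^{At}\setminus\{F\}\Rightarrow F$ and $\emptyset;(\bar\Gamma^{At}\setminus\{F\})\cup\bar\Gamma^{\supset}\rightarrow F$; ($\land$) $\Gamma\Rightarrow A_k/\Gamma\Rightarrow A_1\land A_2$ and $\Sigma;\Theta\rightarrow A_k/\Sigma;\Theta\rightarrow A_1\land A_2$; ($\lor$) $\Sigma_1;\Theta_1\rightarrow C_1$, $\Sigma_2;\Theta_2\rightarrow C_2 / \Sigma_1\cup\Sigma_2;\Theta_1\cap\Theta_2\rightarrow C_1\lor C_2$ if $\Sigma_1\subseteq\Sigma_2\cup\Theta_2$,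 $\Sigma_2\subseteq\Sigma_1\cup\Theta_1$; ($\supset_\in$) $\Gamma\Rightarrow B/\Gamma\Rightarrow A\supset B$ if $A\in\mathrm{Cl}(\Gamma)$, and $\Sigma;\Theta\cup\Lambda\rightarrow B/\Sigma\cup\Lambda;\Theta\rightarrow A\supset B$ if $\Theta\cap\Lambda=\emptyset$, $A\in\mathrm{Cl}(\Sigma\cup\Lambda)$ and no $\Lambda'\subsetneq\Lambda$ has $A\in\mathrm{Cl}(\Sigma\cup\Lambda')$; ($\supset_{\notin}$) $\Gamma\Rightarrow B/\emptyset;\Theta\rightarrow A\supset B$ if $\Theta\subseteq\mathrm{Cl}(\Gamma)\cap\bar\Gamma$, $A\in\mathrm{Cl}(\Gamma)\setminus\mathrm{Cl}(\Theta)$ and every $\Theta'$ with $\Theta\subsetneq\Theta'\subseteq\mathrm{Cl}(\Gamma)\cap\bar\Gamma$ has $A\in\mathrm{Cl}(\Theta')$; join rules with premises $\Sigma_j;\Theta_j\rightarrow A_j$ ($1\le j\le n$, $n\ge1$): let $\Upsilon=\{A_1,\dots,A_n\}$, $\Sigma^{At}=\bigcup_j(\Sigma_j\cap\mathcal V)$, $\Sigma^{\supset}=\bigcup_j(\Sigma_j\cap\mathcal L^{\supset})$, $\Theta^{At}=\bigcap_j(\Theta_j\cap\mathcal V)$, $\Theta^{\supset}=\{Y\supset Z\in\bigcap_j(\Theta_j\cap\mathcal L^{\supset}):Y\in\Upsilon\}$, requiring $\Sigma_i\subseteq\Sigma_j\cup\Theta_j$ ($i\ne j$) and ($Y\supset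 Z\in\Sigma^{\supset}\Rightarrow Y\in\Upsilon$); ($\bowtie^{At}$) conclusion $\Sigma^{At}\cup(\Theta^{At}\setminus\{F\})\cup\Sigma^{\supset}\cup\Theta^{\supset}\Rightarrow F$, $F\in\mathcal V_\bot\setminus\Sigma^{At}$, where each $Y\in\Upsilon$ has some $Y\supset Z\in\mathrm{Sl}(G)$; ($\bowtie^{\lor}$) conclusion $\Sigma^{At}\cup\Theta^{At}\cup\Sigma^{\supset}\cup\Theta^{\supset}\Rightarrow C_1\lor C_2$, $\{C_1,C_2\}\subseteq\Upsilon$, where each $Y\in\Upsilon$ has some $Y\supset Z\in\mathrm{Sl}(G)$ or $Y\lor Z\in\mathrm{Sr}(G)$ or $Z\lor Y\in\mathrm{Sr}(G)$. Write $\sigma_1\mapsto_0\sigma_2$ if some rule instance has conclusion $\sigma_2$ and $\sigma_1$ among its premises; $\mapsto$ is the transitive closure of $\mapsto_0$. -}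

module Defs where

open import Level using (0ℓ)
open import Data.Nat using (ℕ; zero; suc; _+_)
open import Data.Integer as ℤ using (ℤ; +_; _-_)
open import Data.Fin using (Fin)
open import Data.List using (List; []; _∷_; length; tabulate)
open import Data.List.Relation.Unary.All using (All)
open import Data.List.Relation.Unary.Any using (Any)
open import Data.List.Membership.Propositional using () renaming (_∈_ to _∈ₗ_)
open import Data.List.Relation.Unary.Unique.Propositional using (Unique)
open import Data.Product using (Σ; ∃; ∃-syntax; _×_; _,_)
open import Data.Sum using (_⊎_)
open import Data.Empty using (⊥)
open import Relation.Nullary using (¬_)
open import Relation.Binary.PropositionalEquality using (_≡_; _≢_)
open import Relation.Binary.Construct.Closure.Transitive using (TransClosure)
open import Function.Bundles using (_⇔_)
open import Relation.Unary using (Pred; _⊆_; _⊂_; _≐_; _∪_; _∩_; _∖_; ∅; ｛_｝)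

infixr 6 _∧ᶠ_
infixr 5 _∨ᶠ_
infixr 4 _⊃ᶠ_

data Formula : Set where
  var  : ℕ → Formula
  ⊥ᶠ   : Formula
  _∧ᶠ_ : Formula → Formula → Formula
  _∨ᶠ_ : Formula → Formula → Formula
  _⊃ᶠ_ : Formula → Formula → Formula

FSet : Set₁
FSet = Pred Formula 0ℓ

size : Formula → ℕ
size (var _)    = 1
size ⊥ᶠ         = 1
size (A ∧ᶠ B)   = suc (size A + size B)
size (A ∨ᶠ B)   = suc (size A + size B)
size (A ⊃ᶠ B)   = suc (size A + size B)

IsVar : FSet
IsVar X = ∃[ p ] X ≡ var p

IsVar⊥ : FSet
IsVar⊥ X = IsVar X ⊎ X ≡ ⊥ᶠ

IsImp : FSet
IsImp X = ∃[ A ] ∃[ B ] X ≡ (A ⊃ᶠ B)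

mutual
  data Sl (G : Formula) : Formula → Set where
    sl-∧ˡ : ∀ {A B} → Sl G (A ∧ᶠ B) → Sl G A
    sl-∧ʳ : ∀ {A B} → Sl G (A ∧ᶠ B) → Sl G B
    sl-∨ˡ : ∀ {A B} → Sl G (A ∨ᶠ B) → Sl G A
    sl-∨ʳ : ∀ {A B} → Sl G (A ∨ᶠ B) → Sl G B
    sl-⊃  : ∀ {A B} → Sl G (A ⊃ᶠ B) → Sl G B
    sr-⊃  : ∀ {A B} → Sr G (A ⊃ᶠ B) → Sl G A

  data Sr (G : Formula) : Formula → Set where
    sr-G  : Sr G G
    sr-∧ˡ : ∀ {A B} → Sr G (A ∧ᶠ B) → Sr G A
    sr-∧ʳ : ∀ {A B} → Sr G (A ∧ᶠ B) → Sr G B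
    sr-∨ˡ : ∀ {A B} → Sr G (A ∨ᶠ B) → Sr G A
    sr-∨ʳ : ∀ {A B} → Sr G (A ∨ᶠ B) → Sr G B
    sr-⊃r : ∀ {A B} → Sr G (A ⊃ᶠ B) → Sr G B
    sl-⊃l : ∀ {A B} → Sl G (A ⊃ᶠ B) → Sr G A

data Cl (Γ : FSet) : Formula → Set where
  cl-base : ∀ {X} → Γ X → Cl Γ X
  cl-∧    : ∀ {X Y} → Cl Γ X → Cl Γ Y → Cl Γ (X ∧ᶠ Y)
  cl-∨ˡ   : ∀ {X} A → Cl Γ X → Cl Γ (A ∨ᶠ X)
  cl-∨ʳ   : ∀ {X} A → Cl Γ X → Cl Γ (X ∨ᶠ A)
  cl-⊃    : ∀ {X} A → Cl Γ X → Cl Γ (A ⊃ᶠ X)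

module FRJ (G : Formula) where

  Γ̄At : FSet
  Γ̄At = Sl G ∩ IsVar

  Γ̄⊃ : FSet
  Γ̄⊃ = Sl G ∩ IsImp

  Γ̄ : FSet
  Γ̄ = Γ̄At ∪ Γ̄⊃

  data Seq : Set₁ where
    reg : (Γ : FSet) (C : Formula) → Seq
    irr : (Σ Θ : FSet) (C : Formula) → Seq

  Lhs : Seq → FSet
  Lhs (reg Γ C)   = Γ
  Lhs (irr Σ Θ C) = Σ ∪ Θ

  Rhs : Seq → Formula
  Rhs (reg Γ C)   = C
  Rhs (irr Σ Θ C) = C

  tp : Seq → ℕ
  tp (reg _ _)   = 0
  tp (irr _ _ _) = 1

  -- FRJ(G)-sequent: left sets inside Γ̄, right formula in Sr(G)
  WF : Seq → Set
  WF (reg Γ C)   = Γ ⊆ Γ̄ × Sr G C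
  WF (irr Σ Θ C) = Σ ⊆ Γ̄ × Θ ⊆ Γ̄ × Sr G C

  _≈ˢ_ : Seq → Seq → Set
  reg Γ C   ≈ˢ reg Γ' C'    = Γ ≐ Γ' × C ≡ C'
  irr Σ Θ C ≈ˢ irr Σ' Θ' C' = Σ ≐ Σ' × Θ ≐ Θ' × C ≡ C'
  _         ≈ˢ _            = ⊥

  data Rule : List Seq → Seq → Set₁ where
    ax-reg : ∀ F → IsVar⊥ F → Rule [] (reg (Γ̄At ∖ ｛ F ｝) F)
    ax-irr : ∀ F → IsVar⊥ F → Rule [] (irr ∅ ((Γ̄At ∖ ｛ F ｝) ∪ Γ̄⊃) F)
    ∧-reg  : ∀ Γ A₁ A₂ A → (A ≡ A₁ ⊎ A ≡ A₂) →
             Rule (reg Γ A ∷ []) (reg Γ (A₁ ∧ᶠ A₂))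
    ∧-irr  : ∀ Σ Θ A₁ A₂ A → (A ≡ A₁ ⊎ A ≡ A₂) →
             Rule (irr Σ Θ A ∷ []) (irr Σ Θ (A₁ ∧ᶠ A₂))
    ∨-irr  : ∀ Σ₁ Θ₁ C₁ Σ₂ Θ₂ C₂ →
             Σ₁ ⊆ Σ₂ ∪ Θ₂ → Σ₂ ⊆ Σ₁ ∪ Θ₁ →
             Rule (irr Σ₁ Θ₁ C₁ ∷ irr Σ₂ Θ₂ C₂ ∷ [])
                  (irr (Σ₁ ∪ Σ₂) (Θ₁ ∩ Θ₂) (C₁ ∨ᶠ C₂))
    ⊃∈-reg : ∀ Γ A B → Cl Γ A →
             Rule (reg Γ B ∷ []) (reg Γ (A ⊃ᶠ B))
    ⊃∈-irr : ∀ Σ Θ Λ A B →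
             (∀ x → Θ x → Λ x → ⊥) →
             Cl (Σ ∪ Λ) A →
             (∀ (Λ' : FSet) → Λ' ⊂ Λ → ¬ Cl (Σ ∪ Λ') A) →
             Rule (irr Σ (Θ ∪ Λ) B ∷ []) (irr (Σ ∪ Λ) Θ (A ⊃ᶠ B))
    ⊃∉     : ∀ Γ Θ A B →
             Θ ⊆ Cl Γ ∩ Γ̄ →
             Cl Γ A → ¬ Cl Θ A →
             (∀ (Θ' : FSet) → Θ ⊂ Θ' → Θ' ⊆ Cl Γ ∩ Γ̄ → Cl Θ' A) →
             Rule (reg Γ B ∷ []) (irr ∅ Θ (A ⊃ᶠ B))
    ⋈At    : ∀ m (Σs Θs : Fin (suc m) → FSet) (As : Fin (suc m) → Formula) F →
             let Υ   : FSet
                 Υ Y = ∃[ j ] As j ≡ Y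
                 ΣAt : FSet
                 ΣAt x = (∃[ j ] Σs j x) × IsVar x
                 Σ⊃ : FSet
                 Σ⊃ x = (∃[ j ] Σs j x) × IsImp x
                 ΘAt : FSet
                 ΘAt x = (∀ j → Θs j x) × IsVar x
                 Θ⊃ : FSet
                 Θ⊃ x = (∀ j → Θs j x) × (∃[ Y ] ∃[ Z ] (x ≡ (Y ⊃ᶠ Z) × Υ Y))
             in (∀ i j → i ≢ j → Σs i ⊆ Σs j ∪ Θs j) →
                (∀ Y Z → Σ⊃ (Y ⊃ᶠ Z) → Υ Y) →
                IsVar⊥ F → ¬ ΣAt F →
                (∀ Y → Υ Y → ∃[ Z ] Sl G (Y ⊃ᶠ Z)) →
                Rule (tabulate (λ j → irr (Σs j) (Θs j) (As j)))
                     (reg (ΣAt ∪ (ΘAt ∖ ｛ F ｝) ∪ Σ⊃ ∪ Θ⊃) F)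
    ⋈∨     : ∀ m (Σs Θs : Fin (suc m) → FSet) (As : Fin (suc m) → Formula) C₁ C₂ →
             let Υ   : FSet
                 Υ Y = ∃[ j ] As j ≡ Y
                 ΣAt : FSet
                 ΣAt x = (∃[ j ] Σs j x) × IsVar x
                 Σ⊃ : FSet
                 Σ⊃ x = (∃[ j ] Σs j x) × IsImp x
                 ΘAt : FSet
                 ΘAt x = (∀ j → Θs j x) × IsVar x
                 Θ⊃ : FSet
                 Θ⊃ x = (∀ j → Θs j x) × (∃[ Y ] ∃[ Z ] (x ≡ (Y ⊃ᶠ Z) × Υ Y))
             in (∀ i j → i ≢ j → Σs i ⊆ Σs j ∪ Θs j) →
                (∀ Y Z → Σ⊃ (Y ⊃ᶠ Z) → Υ Y) →
                Υ C₁ → Υ C₂ →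
                (∀ Y → Υ Y → (∃[ Z ] Sl G (Y ⊃ᶠ Z)) ⊎ (∃[ Z ] Sr G (Y ∨ᶠ Z))
                                                  ⊎ (∃[ Z ] Sr G (Z ∨ᶠ Y))) →
                Rule (tabulate (λ j → irr (Σs j) (Θs j) (As j)))
                     (reg (ΣAt ∪ ΘAt ∪ Σ⊃ ∪ Θ⊃) (C₁ ∨ᶠ C₂))

  Instance : List Seq → Seq → Set₁
  Instance ps c = Rule ps c × All WF ps × WF c

  _↦₀_ : Seq → Seq → Set₁
  σ₁ ↦₀ σ₂ = ∃[ ps ] ∃[ c ] (Instance ps c × Any (_≈ˢ σ₁) ps × c ≈ˢ σ₂)

  _↦_ : Seq → Seq → Set₁
  _↦_ = TransClosure _↦₀_

  Card : FSet → ℕ → Set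
  Card P n = ∃[ xs ] (Unique xs × (∀ x → (x ∈ₗ xs) ⇔ P x) × length xs ≡ n)

  Triple : Set
  Triple = ℤ × ℤ × ℤ

  Wg : Seq → Triple → Set
  Wg σ (a , b , c) =
    (∃[ n ] (Card (Cl (Lhs σ) ∩ Sl G) n × a ≡ + n)) ×
    b ≡ + tp σ ×
    c ≡ (+ size G) - (+ size (Rhs σ))

_≺_ : ℤ × ℤ × ℤ → ℤ × ℤ × ℤ → Set
(a , b , c) ≺ (a' , b' , c') =
  a ℤ.< a' ⊎ (a ≡ a' × (b ℤ.< b' ⊎ (b ≡ b' × c ℤ.< c')))

_⪯_ : ℤ × ℤ × ℤ → ℤ × ℤ × ℤ → Set
u ⪯ v = u ≺ v ⊎ u ≡ v

module Submission where

-- In every rule of FRJ(G) the left-hand side of the conclusion lies in the closure of the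
-- left-hand side of each premise; as Cl is monotone and idempotent, Cl(Lhs) ∩ Sl(G) can only
-- shrink along ↦.  It shrinks strictly at ⊃∉, which loses A ∈ Cl(Γ) ∖ Cl(Θ), where A ∈ Sl(G)
-- because A ⊃ B ∈ Sr(G).  The join rules pass from irregular premises to a regular conclusion,
-- and every other rule keeps the type and enlarges the right formula.  Right formulas lie in
-- Sr(G), hence are no larger than G, which makes every weight non-negative.

open import Defs
open import Data.Integer using (+_)
open import Data.Product using (_×_; _,_)

open import Function using (_∘_; id)
open import Function.Definitions using (Injective)
open import Function.Bundles using (Equivalence)
open import Data.Nat as ℕ using (ℕ; zero; suc; _≤_; _<_; _∸_; s≤s; z<s)
open import Data.Nat.Properties using (<⇒≤; <-≤-trans; ≤-<-trans; <-trans; ≤-reflexive; ≤-refl; m≤m+n; m≤n+m; m≤n⇒m<n∨m≡n)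
import Data.Integer as ℤ
open import Data.Integer.Properties using ([+m]-[+n]≡m⊖n; ⊖-≥; +-monoʳ-<; neg-mono-<)
open import Data.Product using (proj₁; proj₂; map₁)
open import Data.Sum as Sum using (_⊎_; inj₁; inj₂; [_,_]′)
open import Data.Fin using (Fin; zero; suc) renaming (_≟_ to _≟ᶠ_)
open import Data.Fin.Properties using (injective⇒≤)
open import Data.List using (List; _∷_; length; lookup)
open import Data.List.Relation.Unary.Any using (here; there)
open import Data.List.Relation.Unary.All as All using ()
open import Data.List.Relation.Unary.AllPairs using (_∷_)
open import Data.List.Relation.Unary.Unique.Propositional using (Unique)
open import Data.List.Membership.Propositional using (_∈_; _∉_; find)
open import Data.List.Membership.Propositional.Properties using (∈-lookup; ∈-tabulate⁻)
open import Data.List.Membership.Setoid.Properties using (index-injective; ∉⇒All[≉])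
open import Data.List.Relation.Binary.Subset.Propositional using () renaming (_⊆_ to _⊆ₗ_)
open import Relation.Nullary using (¬_; yes; no; contradiction)
open import Relation.Binary.PropositionalEquality
open import Relation.Binary.Construct.Closure.Transitive using ([_]; _∷_)
open import Relation.Unary using (_⊆_; _∪_; _∩_; ∅; ⋃; ⋂)


module _ {a} {A : Set a} where

  lookup-injective : ∀ {xs : List A} → Unique xs → Injective _≡_ _≡_ (lookup xs)
  lookup-injective {_ ∷ _} _               {zero}  {zero}  _ = refl
  lookup-injective {_ ∷ _} (x∉xs ∷ _)      {zero}  {suc j} e = contradiction e (All.lookup x∉xs (∈-lookup j))
  lookup-injective {_ ∷ _} (x∉xs ∷ _)      {suc i} {zero}  e = contradiction (sym e) (All.lookup x∉xs (∈-lookup i))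
  lookup-injective {_ ∷ _} (_ ∷ unique-xs) {suc i} {suc j} e = cong suc (lookup-injective unique-xs e)

  Unique-⊆⇒length≤ : ∀ {xs ys : List A} → Unique xs → xs ⊆ₗ ys → length xs ≤ length ys
  Unique-⊆⇒length≤ unique-xs xs⊆ys =
    injective⇒≤ λ same-index →
      lookup-injective unique-xs (index-injective (setoid A) (xs⊆ys (∈-lookup _)) (xs⊆ys (∈-lookup _)) same-index)

  Unique-⊆⇒length< : ∀ {xs ys : List A} {z} → Unique xs → xs ⊆ₗ ys → z ∈ ys → z ∉ xs →
                     length xs < length ys
  Unique-⊆⇒length< unique-xs xs⊆ys z∈ys z∉xs =
    Unique-⊆⇒length≤ (∉⇒All[≉] (setoid A) z∉xs ∷ unique-xs)
      λ { (here refl) → z∈ys ; (there x∈xs) → xs⊆ys x∈xs }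


Cl-mono : ∀ {Γ Δ : FSet} → Γ ⊆ Δ → Cl Γ ⊆ Cl Δ
Cl-mono Γ⊆Δ (cl-base x) = cl-base (Γ⊆Δ x)
Cl-mono Γ⊆Δ (cl-∧ x y)  = cl-∧ (Cl-mono Γ⊆Δ x) (Cl-mono Γ⊆Δ y)
Cl-mono Γ⊆Δ (cl-∨ˡ A x) = cl-∨ˡ A (Cl-mono Γ⊆Δ x)
Cl-mono Γ⊆Δ (cl-∨ʳ A x) = cl-∨ʳ A (Cl-mono Γ⊆Δ x)
Cl-mono Γ⊆Δ (cl-⊃ A x)  = cl-⊃ A (Cl-mono Γ⊆Δ x)

Cl-idem : ∀ {Γ : FSet} → Cl (Cl Γ) ⊆ Cl Γ
Cl-idem (cl-base x) = x
Cl-idem (cl-∧ x y)  = cl-∧ (Cl-idem x) (Cl-idem y)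
Cl-idem (cl-∨ˡ A x) = cl-∨ˡ A (Cl-idem x)
Cl-idem (cl-∨ʳ A x) = cl-∨ʳ A (Cl-idem x)
Cl-idem (cl-⊃ A x)  = cl-⊃ A (Cl-idem x)

size-<ˡ : ∀ A B → size A < suc (size A ℕ.+ size B)
size-<ˡ A B = s≤s (m≤m+n (size A) (size B))

size-<ʳ : ∀ A B → size B < suc (size A ℕ.+ size B)
size-<ʳ A B = s≤s (m≤n+m (size B) (size A))

component-< : ∀ {A A₁ A₂} → A ≡ A₁ ⊎ A ≡ A₂ → size A < suc (size A₁ ℕ.+ size A₂)
component-< {A₁ = A₁} {A₂} (inj₁ refl) = size-<ˡ A₁ A₂
component-< {A₁ = A₁} {A₂} (inj₂ refl) = size-<ʳ A₁ A₂

private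
  <-≤⇒≤ : ∀ {m n o} → m < n → n ≤ o → m ≤ o
  <-≤⇒≤ m<n n≤o = <⇒≤ (<-≤-trans m<n n≤o)

mutual
  Sl⇒size≤ : ∀ {G C} → Sl G C → size C ≤ size G
  Sl⇒size≤ (sl-∧ˡ {A} {B} s) = <-≤⇒≤ (size-<ˡ A B) (Sl⇒size≤ s)
  Sl⇒size≤ (sl-∧ʳ {A} {B} s) = <-≤⇒≤ (size-<ʳ A B) (Sl⇒size≤ s)
  Sl⇒size≤ (sl-∨ˡ {A} {B} s) = <-≤⇒≤ (size-<ˡ A B) (Sl⇒size≤ s)
  Sl⇒size≤ (sl-∨ʳ {A} {B} s) = <-≤⇒≤ (size-<ʳ A B) (Sl⇒size≤ s)
  Sl⇒size≤ (sl-⊃ {A} {B} s)  = <-≤⇒≤ (size-<ʳ A B) (Sl⇒size≤ s)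
  Sl⇒size≤ (sr-⊃ {A} {B} s)  = <-≤⇒≤ (size-<ˡ A B) (Sr⇒size≤ s)

  Sr⇒size≤ : ∀ {G C} → Sr G C → size C ≤ size G
  Sr⇒size≤ sr-G               = ≤-refl
  Sr⇒size≤ (sr-∧ˡ {A} {B} s)  = <-≤⇒≤ (size-<ˡ A B) (Sr⇒size≤ s)
  Sr⇒size≤ (sr-∧ʳ {A} {B} s)  = <-≤⇒≤ (size-<ʳ A B) (Sr⇒size≤ s)
  Sr⇒size≤ (sr-∨ˡ {A} {B} s)  = <-≤⇒≤ (size-<ˡ A B) (Sr⇒size≤ s)
  Sr⇒size≤ (sr-∨ʳ {A} {B} s)  = <-≤⇒≤ (size-<ʳ A B) (Sr⇒size≤ s)
  Sr⇒size≤ (sr-⊃r {A} {B} s)  = <-≤⇒≤ (size-<ʳ A B) (Sr⇒size≤ s)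
  Sr⇒size≤ (sl-⊃l {A} {B} s)  = <-≤⇒≤ (size-<ˡ A B) (Sl⇒size≤ s)


origin-⪯ : ∀ a b c → (+ 0 , + 0 , + 0) ⪯ (+ a , + b , + c)
origin-⪯ (suc a) b       c       = inj₁ (inj₁ (ℤ.+<+ z<s))
origin-⪯ zero    (suc b) c       = inj₁ (inj₂ (refl , inj₁ (ℤ.+<+ z<s)))
origin-⪯ zero    zero    (suc c) = inj₁ (inj₂ (refl , inj₂ (refl , ℤ.+<+ z<s)))
origin-⪯ zero    zero    zero    = inj₂ refl

≺-lex : ∀ {n₁ n₂ t₁ t₂ : ℕ} {c₁ c₂ : ℤ.ℤ} → n₂ ≤ n₁ →
        n₂ < n₁ ⊎ t₂ < t₁ ⊎ (t₂ ≡ t₁ × c₂ ℤ.< c₁) →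
        (+ n₂ , + t₂ , c₂) ≺ (+ n₁ , + t₁ , c₁)
≺-lex _ (inj₁ n₂<n₁) = inj₁ (ℤ.+<+ n₂<n₁)
≺-lex n₂≤n₁ (inj₂ later) with m≤n⇒m<n∨m≡n n₂≤n₁
... | inj₁ n₂<n₁ = inj₁ (ℤ.+<+ n₂<n₁)
... | inj₂ refl  = inj₂ (refl , Sum.map ℤ.+<+ (map₁ (cong +_)) later)

[+m]-[+n]≡+[m∸n] : ∀ {m n} → n ≤ m → + m ℤ.- + n ≡ + (m ∸ n)
[+m]-[+n]≡+[m∸n] {m} {n} n≤m = trans ([+m]-[+n]≡m⊖n m n) (⊖-≥ n≤m)

[+m]-[+n]-antimonoʳ-< : ∀ m {n o} → n < o → + m ℤ.- + o ℤ.< + m ℤ.- + n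
[+m]-[+n]-antimonoʳ-< m n<o = +-monoʳ-< (+ m) (neg-mono-< (ℤ.+<+ n<o))


module _ (G : Formula) where
  open FRJ G

  ClSl : Seq → FSet
  ClSl σ = Cl (Lhs σ) ∩ Sl G

  data StrictDrop (σ₁ σ₂ : Seq) : Set where
    loses     : ∀ {x} → ClSl σ₁ x → ¬ ClSl σ₂ x → StrictDrop σ₁ σ₂
    tp-drops  : tp σ₂ < tp σ₁ → StrictDrop σ₁ σ₂
    Rhs-grows : tp σ₂ ≡ tp σ₁ → size (Rhs σ₁) < size (Rhs σ₂) → StrictDrop σ₁ σ₂

  record Descent (σ₁ σ₂ : Seq) : Set where
    constructor descent
    field
      ClSl-⊇ : ClSl σ₂ ⊆ ClSl σ₁
      strict : StrictDrop σ₁ σ₂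

  Descent-trans : ∀ {σ₁ σ₂ σ₃} → Descent σ₁ σ₂ → Descent σ₂ σ₃ → Descent σ₁ σ₃
  Descent-trans {σ₁} {σ₂} {σ₃} (descent ⊇₁₂ s₁₂) (descent ⊇₂₃ s₂₃) =
    descent (⊇₁₂ ∘ ⊇₂₃) (StrictDrop-trans s₁₂ s₂₃)
    where
    StrictDrop-trans : StrictDrop σ₁ σ₂ → StrictDrop σ₂ σ₃ → StrictDrop σ₁ σ₃
    StrictDrop-trans (loses x∈₁ x∉₂)      _                     = loses x∈₁ (x∉₂ ∘ ⊇₂₃)
    StrictDrop-trans _                    (loses x∈₂ x∉₃)       = loses (⊇₁₂ x∈₂) x∉₃
    StrictDrop-trans (tp-drops <₁₂)       (tp-drops <₂₃)        = tp-drops (<-trans <₂₃ <₁₂)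
    StrictDrop-trans (tp-drops <₁₂)       (Rhs-grows ≡₂₃ _)     = tp-drops (≤-<-trans (≤-reflexive ≡₂₃) <₁₂)
    StrictDrop-trans (Rhs-grows ≡₁₂ _)    (tp-drops <₂₃)        = tp-drops (<-≤-trans <₂₃ (≤-reflexive ≡₁₂))
    StrictDrop-trans (Rhs-grows ≡₁₂ <₁₂)  (Rhs-grows ≡₂₃ <₂₃)   = Rhs-grows (trans ≡₂₃ ≡₁₂) (<-trans <₁₂ <₂₃)

  ≈ˢ-sym : ∀ {σ σ'} → σ ≈ˢ σ' → σ' ≈ˢ σ
  ≈ˢ-sym {reg _ _}   {reg _ _}   ((to , from) , e)                   = (from , to) , sym e
  ≈ˢ-sym {irr _ _ _} {irr _ _ _} ((to , from) , (to' , from') , e) = (from , to) , (from' , to') , sym e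

  ≈ˢ⇒Lhs⊆ : ∀ {σ σ'} → σ ≈ˢ σ' → Lhs σ ⊆ Lhs σ'
  ≈ˢ⇒Lhs⊆ {reg _ _}   {reg _ _}   ((to , _) , _)             = to
  ≈ˢ⇒Lhs⊆ {irr _ _ _} {irr _ _ _} ((to , _) , (to' , _) , _) = Sum.map to to'

  ≈ˢ⇒tp≡ : ∀ {σ σ'} → σ ≈ˢ σ' → tp σ ≡ tp σ'
  ≈ˢ⇒tp≡ {reg _ _}   {reg _ _}   _ = refl
  ≈ˢ⇒tp≡ {irr _ _ _} {irr _ _ _} _ = refl

  ≈ˢ⇒Rhs≡ : ∀ {σ σ'} → σ ≈ˢ σ' → Rhs σ ≡ Rhs σ'
  ≈ˢ⇒Rhs≡ {reg _ _}   {reg _ _}   (_ , e)     = e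
  ≈ˢ⇒Rhs≡ {irr _ _ _} {irr _ _ _} (_ , _ , e) = e

  ≈ˢ⇒ClSl⊆ : ∀ {σ σ'} → σ ≈ˢ σ' → ClSl σ ⊆ ClSl σ'
  ≈ˢ⇒ClSl⊆ σ≈σ' (x∈Cl , x∈Sl) = Cl-mono (≈ˢ⇒Lhs⊆ σ≈σ') x∈Cl , x∈Sl

  Descent-resp-≈ˢ : ∀ {σ₁ σ₁' σ₂ σ₂'} → σ₁ ≈ˢ σ₁' → σ₂ ≈ˢ σ₂' → Descent σ₁ σ₂ → Descent σ₁' σ₂'
  Descent-resp-≈ˢ {σ₁} {σ₁'} {σ₂} {σ₂'} ≈₁ ≈₂ (descent ⊇₁₂ s) =
    descent (≈ˢ⇒ClSl⊆ ≈₁ ∘ ⊇₁₂ ∘ ≈ˢ⇒ClSl⊆ (≈ˢ-sym ≈₂)) (StrictDrop-resp s)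
    where
    StrictDrop-resp : StrictDrop σ₁ σ₂ → StrictDrop σ₁' σ₂'
    StrictDrop-resp (loses x∈₁ x∉₂) = loses (≈ˢ⇒ClSl⊆ ≈₁ x∈₁) (x∉₂ ∘ ≈ˢ⇒ClSl⊆ (≈ˢ-sym ≈₂))
    StrictDrop-resp (tp-drops tp<)  = tp-drops (subst₂ _<_ (≈ˢ⇒tp≡ ≈₂) (≈ˢ⇒tp≡ ≈₁) tp<)
    StrictDrop-resp (Rhs-grows tp≡ size<) =
      Rhs-grows (trans (sym (≈ˢ⇒tp≡ ≈₂)) (trans tp≡ (≈ˢ⇒tp≡ ≈₁)))
                (subst₂ _<_ (cong size (≈ˢ⇒Rhs≡ ≈₁)) (cong size (≈ˢ⇒Rhs≡ ≈₂)) size<)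

  Lhs⊆Cl⇒ClSl⊇ : ∀ {p c} → Lhs c ⊆ Cl (Lhs p) → ClSl c ⊆ ClSl p
  Lhs⊆Cl⇒ClSl⊇ c⊆p (x∈Cl , x∈Sl) = Cl-idem (Cl-mono c⊆p x∈Cl) , x∈Sl

  descent-by-Rhs : ∀ {p c} → Lhs c ⊆ Lhs p → tp c ≡ tp p → size (Rhs p) < size (Rhs c) → Descent p c
  descent-by-Rhs {p} {c} c⊆p tp≡ size< = descent (Lhs⊆Cl⇒ClSl⊇ {p} {c} (cl-base ∘ c⊆p)) (Rhs-grows tp≡ size<)

  descent-by-tp : ∀ {p c} → Lhs c ⊆ Lhs p → tp c < tp p → Descent p c
  descent-by-tp {p} {c} c⊆p tp< = descent (Lhs⊆Cl⇒ClSl⊇ {p} {c} (cl-base ∘ c⊆p)) (tp-drops tp<)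

  join-⊆ : ∀ {m} (Σs Θs : Fin (suc m) → FSet) → (∀ i j → i ≢ j → Σs i ⊆ Σs j ∪ Θs j) →
           ∀ j → ⋃ _ Σs ∪ ⋂ _ Θs ⊆ Σs j ∪ Θs j
  join-⊆ Σs Θs Σs⊆ j (inj₁ (i , x∈Σᵢ)) with i ≟ᶠ j
  ... | yes refl = inj₁ x∈Σᵢ
  ... | no  i≢j  = Σs⊆ i j i≢j x∈Σᵢ
  join-⊆ Σs Θs Σs⊆ j (inj₂ x∈Θ) = inj₂ (x∈Θ j)

  rule-descent : ∀ {ps c p} → Rule ps c → WF c → p ∈ ps → Descent p c
  rule-descent (ax-reg _ _) _ ()
  rule-descent (ax-irr _ _) _ ()
  rule-descent (∧-reg _ _ _ _ k) _ (here refl) = descent-by-Rhs id refl (component-< k)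
  rule-descent (∧-reg _ _ _ _ _) _ (there ())
  rule-descent (∧-irr _ _ _ _ _ k) _ (here refl) = descent-by-Rhs id refl (component-< k)
  rule-descent (∧-irr _ _ _ _ _ _) _ (there ())
  rule-descent (∨-irr _ _ C₁ _ _ C₂ _ Σ₂⊆) _ (here refl) =
    descent-by-Rhs [ [ inj₁ , Σ₂⊆ ]′ , inj₂ ∘ proj₁ ]′ refl (size-<ˡ C₁ C₂)
  rule-descent (∨-irr _ _ C₁ _ _ C₂ Σ₁⊆ _) _ (there (here refl)) =
    descent-by-Rhs [ [ Σ₁⊆ , inj₁ ]′ , inj₂ ∘ proj₂ ]′ refl (size-<ʳ C₁ C₂)
  rule-descent (∨-irr _ _ _ _ _ _ _ _) _ (there (there ()))
  rule-descent (⊃∈-reg _ A B _) _ (here refl) = descent-by-Rhs id refl (size-<ʳ A B)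
  rule-descent (⊃∈-reg _ _ _ _) _ (there ())
  rule-descent (⊃∈-irr _ _ _ A B _ _ _) _ (here refl) =
    descent-by-Rhs [ [ inj₁ , inj₂ ∘ inj₂ ]′ , inj₂ ∘ inj₁ ]′ refl (size-<ʳ A B)
  rule-descent (⊃∈-irr _ _ _ _ _ _ _ _) _ (there ())
  rule-descent (⊃∉ Γ Θ A B Θ⊆ A∈ A∉ _) (_ , _ , A⊃B∈Sr) (here refl) =
    descent (Lhs⊆Cl⇒ClSl⊇ {reg Γ B} {irr ∅ Θ (A ⊃ᶠ B)} [ (λ ()) , proj₁ ∘ Θ⊆ ]′)
            (loses (A∈ , sr-⊃ A⊃B∈Sr) (λ (A∈Cl , _) → A∉ (Cl-mono [ (λ ()) , id ]′ A∈Cl)))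
  rule-descent (⊃∉ _ _ _ _ _ _ _ _) _ (there ())
  rule-descent {c = c} (⋈At _ Σs Θs As _ Σs⊆ _ _ _ _) _ p∈ps
    with ∈-tabulate⁻ {f = λ j → irr (Σs j) (Θs j) (As j)} p∈ps
  ... | j , refl = descent-by-tp (join-⊆ Σs Θs Σs⊆ j ∘ concl-⊆) z<s
    where
    concl-⊆ : Lhs c ⊆ ⋃ _ Σs ∪ ⋂ _ Θs
    concl-⊆ (inj₁ (x∈Σ , _))                = inj₁ x∈Σ
    concl-⊆ (inj₂ (inj₁ ((x∈Θ , _) , _)))   = inj₂ x∈Θ
    concl-⊆ (inj₂ (inj₂ (inj₁ (x∈Σ , _))))  = inj₁ x∈Σ
    concl-⊆ (inj₂ (inj₂ (inj₂ (x∈Θ , _))))  = inj₂ x∈Θ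
  rule-descent {c = c} (⋈∨ _ Σs Θs As _ _ Σs⊆ _ _ _ _) _ p∈ps
    with ∈-tabulate⁻ {f = λ j → irr (Σs j) (Θs j) (As j)} p∈ps
  ... | j , refl = descent-by-tp (join-⊆ Σs Θs Σs⊆ j ∘ concl-⊆) z<s
    where
    concl-⊆ : Lhs c ⊆ ⋃ _ Σs ∪ ⋂ _ Θs
    concl-⊆ (inj₁ (x∈Σ , _))               = inj₁ x∈Σ
    concl-⊆ (inj₂ (inj₁ (x∈Θ , _)))        = inj₂ x∈Θ
    concl-⊆ (inj₂ (inj₂ (inj₁ (x∈Σ , _)))) = inj₁ x∈Σ
    concl-⊆ (inj₂ (inj₂ (inj₂ (x∈Θ , _)))) = inj₂ x∈Θ

  ↦₀⇒Descent : ∀ {σ₁ σ₂} → σ₁ ↦₀ σ₂ → Descent σ₁ σ₂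
  ↦₀⇒Descent (_ , _ , (rule , _ , wf-c) , premise , c≈σ₂) with find premise
  ... | p , p∈ps , p≈σ₁ = Descent-resp-≈ˢ p≈σ₁ c≈σ₂ (rule-descent rule wf-c p∈ps)

  ↦⇒Descent : ∀ {σ₁ σ₂} → σ₁ ↦ σ₂ → Descent σ₁ σ₂
  ↦⇒Descent [ step ]       = ↦₀⇒Descent step
  ↦⇒Descent (step ∷ steps) = Descent-trans (↦₀⇒Descent step) (↦⇒Descent steps)

  ↦⇒Rhs∈Sr : ∀ {σ₁ σ₂} → σ₁ ↦ σ₂ → Sr G (Rhs σ₂)
  ↦⇒Rhs∈Sr [ (_ , c , (_ , _ , wf-c) , _ , c≈σ₂) ] = subst (Sr G) (≈ˢ⇒Rhs≡ c≈σ₂) (WF⇒Rhs∈Sr c wf-c)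
    where
    WF⇒Rhs∈Sr : ∀ σ → WF σ → Sr G (Rhs σ)
    WF⇒Rhs∈Sr (reg _ _)   (_ , C∈Sr)     = C∈Sr
    WF⇒Rhs∈Sr (irr _ _ _) (_ , _ , C∈Sr) = C∈Sr
  ↦⇒Rhs∈Sr (_ ∷ steps) = ↦⇒Rhs∈Sr steps

  Card-mono : ∀ {P Q : FSet} {m n} → Card P m → Card Q n → P ⊆ Q → m ≤ n
  Card-mono (xs , unique-xs , xs⇔P , refl) (ys , _ , ys⇔Q , refl) P⊆Q =
    Unique-⊆⇒length≤ unique-xs (λ {x} → Equivalence.from (ys⇔Q x) ∘ P⊆Q ∘ Equivalence.to (xs⇔P x))

  Card-mono-< : ∀ {P Q : FSet} {m n x} → Card P m → Card Q n → P ⊆ Q → Q x → ¬ P x → m < n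
  Card-mono-< {x = x} (xs , unique-xs , xs⇔P , refl) (ys , _ , ys⇔Q , refl) P⊆Q x∈Q x∉P =
    Unique-⊆⇒length< unique-xs (λ {y} → Equivalence.from (ys⇔Q y) ∘ P⊆Q ∘ Equivalence.to (xs⇔P y))
      (Equivalence.from (ys⇔Q x) x∈Q) (x∉P ∘ Equivalence.to (xs⇔P x))

  Descent⇒Wg≺ : ∀ {σ₁ σ₂ w₁ w₂} → Descent σ₁ σ₂ → Wg σ₁ w₁ → Wg σ₂ w₂ → w₂ ≺ w₁
  Descent⇒Wg≺ {σ₁} {σ₂} {_ , _ , _} {_ , _ , _} (descent ⊇₁₂ s)
    ((n₁ , card₁ , refl) , refl , refl) ((n₂ , card₂ , refl) , refl , refl) =
    ≺-lex (Card-mono card₂ card₁ ⊇₁₂) (component-drop s)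
    where
    component-drop : StrictDrop σ₁ σ₂ →
                     n₂ < n₁ ⊎ tp σ₂ < tp σ₁ ⊎
                     (tp σ₂ ≡ tp σ₁ × + size G ℤ.- + size (Rhs σ₂) ℤ.< + size G ℤ.- + size (Rhs σ₁))
    component-drop (loses x∈₁ x∉₂)       = inj₁ (Card-mono-< card₂ card₁ ⊇₁₂ x∈₁ x∉₂)
    component-drop (tp-drops tp<)        = inj₂ (inj₁ tp<)
    component-drop (Rhs-grows tp≡ size<) = inj₂ (inj₂ (tp≡ , [+m]-[+n]-antimonoʳ-< (size G) size<))

  Rhs∈Sr⇒origin-⪯-Wg : ∀ {σ w} → Sr G (Rhs σ) → Wg σ w → (+ 0 , + 0 , + 0) ⪯ w
  Rhs∈Sr⇒origin-⪯-Wg {σ} {_ , _ , _} Rhs∈Sr ((n , _ , refl) , refl , refl)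
    rewrite [+m]-[+n]≡+[m∸n] (Sr⇒size≤ Rhs∈Sr) = origin-⪯ n (tp σ) _

lemma3p12 : ∀ (G : Formula) {σ₁ σ₂ : FRJ.Seq G} →
    FRJ._↦_ G σ₁ σ₂ →
    ∀ {w₁ w₂} → FRJ.Wg G σ₁ w₁ → FRJ.Wg G σ₂ w₂ →
    ((+ 0 , + 0 , + 0) ⪯ w₂) × (w₂ ≺ w₁)
lemma3p12 G σ₁↦σ₂ wg₁ wg₂ =
  Rhs∈Sr⇒origin-⪯-Wg G (↦⇒Rhs∈Sr G σ₁↦σ₂) wg₂ , Descent⇒Wg≺ G (↦⇒Descent G σ₁↦σ₂) wg₁ wg₂
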